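{- There are no positive integers $r, m, n, k$ with $m \geq 2$ and $n \geq 2$ such that \[ L_m^{n+k} + L_m^{n} = L_r . \]
   Context: $(L_t)_{t\ge 0}$ denotes the Lucas sequence defined by $L_0 = 2$, $L_1 = 1$, and $L_t = L_{t-1} + L_{t-2}$ for $t \geq 2$. Here $L_m^{j}$ denotes the $j$-th power of the Lucas number $L_m$. -}

module Defs where

open import Data.Nat using (ℕ; zero; suc; _+_)

L : ℕ → ℕ
L zero = 2
L (suc zero) = 1
L (suc (suc t)) = L (suc t) + L t

{-# OPTIONS --safe #-}

-- Write x = L m. As x divides the left-hand side, L m ∣ L r, which forces r = m t with t odd
-- (reduce r modulo 2m, using L m ∣ L (a + 2m) ⇔ L m ∣ L a). The sequence j ↦ L (m j) is the Lucas
-- sequence V(x, (-1)^m), so reducing the equation modulo x - 1, x + 1 or x² + 1, where x acts as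
-- 1, -1 or i, compares V_t(1, (-1)^m), V_t(-1, -1) or V_t(i, -1) with 2, (-1)^(n+k) + (-1)^n or
-- i^(n+k) + i^n. For even m, V_t(1, 1) ∈ {1, -2} contradicts x - 1 ≥ 6. For odd m split on x mod 4:
-- if 4 ∣ x, then 8 divides the left-hand side but no Lucas number; if x ≡ 1, then
-- L t = V_t(1, -1) ≡ 2 (mod 4); if x ≡ 3, comparing Gaussian integers of small norm shows that n and
-- n + k are odd, and then V_t(-1, -1) = -L t gives L t ≡ 2 (mod 4) again, impossible for odd t.
-- The case m = 2 is a sieve modulo 2889 = 3³ · 107, and m = 3 is the mod 8 argument. Every
-- residue fact is checked by computing a finite orbit of the recurrence that is closed under it.

module Submission where

open import Defs
open import Data.Nat using (ℕ; zero; suc)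
import Data.Nat as ℕ
open import Data.Product using (∃-syntax; _×_; _,_; proj₁; proj₂)
open import Data.Sum using (_⊎_; inj₁; inj₂; [_,_]′)
open import Function using (_∘_)
open import Data.List using (List; iterate)
open import Data.List.Relation.Unary.All using (All; all?; lookup)
open import Data.List.Membership.Propositional using (_∈_)
open import Data.List.Relation.Unary.Any using (here)
open import Relation.Nullary using (¬_; ¬?; contradiction)
open import Relation.Nullary.Decidable using (Dec; True; toWitness; _×-dec_; _⊎-dec_)
open import Relation.Unary using (Decidable)
open import Relation.Binary.Definitions using (DecidableEquality)
open import Relation.Binary.PropositionalEquality
  using (_≡_; _≢_; refl; sym; trans; cong; cong₂; subst; subst₂; module ≡-Reasoning)
open import Data.Product.Properties using (≡-dec)

odd-subsequence : ∀ {A : Set} (f : A → A) (s : ℕ → A) → (∀ j → s (suc j) ≡ f (s j)) →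
                  ∀ q → s (suc (suc q ℕ.+ suc q)) ≡ f (f (s (suc (q ℕ.+ q))))
odd-subsequence f s s-suc q = begin
  s (suc (suc q ℕ.+ suc q))       ≡⟨ cong (λ i → s (suc (suc i))) (+-suc q q) ⟩
  s (suc (suc (suc (q ℕ.+ q))))   ≡⟨ s-suc _ ⟩
  f (s (suc (suc (q ℕ.+ q))))     ≡⟨ cong f (s-suc _) ⟩
  f (f (s (suc (q ℕ.+ q))))       ∎
  where
  open ≡-Reasoning
  open import Data.Nat.Properties using (+-suc)

-- The implicit True-arguments below are found by evaluating the decision procedures; this is where
-- all the finite residue computations of the proof take place.
module Orbit {A : Set} (_≟ᴬ_ : DecidableEquality A) (f : A → A) where

  open import Data.List.Membership.DecPropositional _≟ᴬ_ using (_∈?_)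

  closed? : ∀ a p → Dec (All (λ b → f b ∈ iterate f a p) (iterate f a p))
  closed? a p = all? (λ b → f b ∈? iterate f a p) (iterate f a p)

  module _ (s : ℕ → A) (s-suc : ∀ j → s (suc j) ≡ f (s j)) (p : ℕ)
           {closed : True (closed? (s 0) (suc p))} where

    ∈-orbit : ∀ j → s j ∈ iterate f (s 0) (suc p)
    ∈-orbit zero    = here refl
    ∈-orbit (suc j) =
      subst (_∈ iterate f (s 0) (suc p)) (sym (s-suc j)) (lookup (toWitness closed) (∈-orbit j))

    invariant : ∀ {P : A → Set} (P? : Decidable P) {holds : True (all? P? (iterate f (s 0) (suc p)))} →
                ∀ j → P (s j)
    invariant P? {holds} j = lookup (toWitness holds) (∈-orbit j)

module ℕ-Lemmas where

  open import Data.Nat using (_+_; _*_; _^_; _%_; _≤_; _<_; _≟_; z≤n; s≤s; NonZero)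
  open import Data.Nat.Properties
    using (≤-trans; <-trans; ≤-refl; <⇒≤; m≤m+n; m<m+n; m≤n⇒m<n∨m≡n; +-suc; +-cancelˡ-<;
           +-identityʳ)
  open import Data.Nat.DivMod using (%-distribˡ-+; %-distribˡ-*)
  open import Data.Nat.Divisibility
    using (_∣_; divides; ∣-trans; ∣m∣n⇒∣m+n; ∣m⇒∣m*n; *-pres-∣; m∣m*n; n∣m⇒m%n≡0)
  open ≡-Reasoning

  record Solution (m n k r : ℕ) : Set where
    constructor solution
    field equation : L m ^ (n + k) + L m ^ n ≡ L r

  m<m+n⇒0<n : ∀ m {n} → m < m + n → 0 < n
  m<m+n⇒0<n m {n} m<m+n = +-cancelˡ-< m 0 n (subst (_< m + n) (sym (+-identityʳ m)) m<m+n)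

  parity : ∀ m → (∃[ h ] m ≡ h + h) ⊎ (∃[ h ] m ≡ suc (h + h))
  parity zero    = inj₁ (0 , refl)
  parity (suc m) with parity m
  ... | inj₁ (h , refl) = inj₂ (h , refl)
  ... | inj₂ (h , refl) = inj₁ (suc h , cong suc (sym (+-suc h h)))

  L-pos : ∀ j → 0 < L j
  L-pos 0             = s≤s z≤n
  L-pos 1             = s≤s z≤n
  L-pos (suc (suc j)) = ≤-trans (L-pos (suc j)) (m≤m+n _ _)

  L[1+j]<L[2+j] : ∀ j → L (suc j) < L (suc (suc j))
  L[1+j]<L[2+j] j = m<m+n (L (suc j)) (L-pos j)

  L-suc-mono-< : ∀ {i j} → i < j → L (suc i) < L (suc j)
  L-suc-mono-< {i} {suc j} (s≤s i≤j) with m≤n⇒m<n∨m≡n i≤j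
  ... | inj₁ i<j  = <-trans (L-suc-mono-< i<j) (L[1+j]<L[2+j] j)
  ... | inj₂ refl = L[1+j]<L[2+j] i

  L-suc-mono-≤ : ∀ {i j} → i ≤ j → L (suc i) ≤ L (suc j)
  L-suc-mono-≤ i≤j with m≤n⇒m<n∨m≡n i≤j
  ... | inj₁ i<j  = <⇒≤ (L-suc-mono-< i<j)
  ... | inj₂ refl = ≤-refl

  L-mono-< : ∀ {i j} → 2 ≤ j → i < j → L i < L j
  L-mono-< {zero}  {suc j} (s≤s 1≤j) _         = L-suc-mono-≤ 1≤j
  L-mono-< {suc i} {suc j} _         (s≤s i<j) = L-suc-mono-< i<j

  7≤L : ∀ {m} → 4 ≤ m → 7 ≤ L m
  7≤L {suc m} (s≤s 3≤m) = L-suc-mono-≤ 3≤m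

  Solution⇒L∣L : ∀ {m n k r} → 1 ≤ n → Solution m n k r → L m ∣ L r
  Solution⇒L∣L {m} {suc n} {k} _ (solution eq) =
    subst (L m ∣_) eq (∣m∣n⇒∣m+n (m∣m*n (L m ^ (n + k))) (m∣m*n (L m ^ n)))

  lucasStep : (M : ℕ) .{{_ : NonZero M}} → ℕ × ℕ → ℕ × ℕ
  lucasStep M (a , b) = b , (b + a) % M

  L-mod : (M : ℕ) .{{_ : NonZero M}} → ℕ → ℕ × ℕ
  L-mod M j = L j % M , L (suc j) % M

  L-mod-suc : ∀ M .{{_ : NonZero M}} j → L-mod M (suc j) ≡ lucasStep M (L-mod M j)
  L-mod-suc M j = cong (L (suc j) % M ,_) (%-distribˡ-+ (L (suc j)) (L j) M)

  L%8≢0 : ∀ j → L j % 8 ≢ 0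
  L%8≢0 = invariant (L-mod 8) (L-mod-suc 8) 11 (λ s → ¬? (proj₁ s ≟ 0))
    where open Orbit (≡-dec _≟_ _≟_) (lucasStep 8)

  L[1+2q]%4≢2 : ∀ q → L (suc (q + q)) % 4 ≢ 2
  L[1+2q]%4≢2 = invariant (λ q → L-mod 4 (suc (q + q))) (odd-subsequence (lucasStep 4) (L-mod 4) (L-mod-suc 4))
                  2 (λ s → ¬? (proj₁ s ≟ 2))
    where open Orbit (≡-dec _≟_ _≟_) (lucasStep 4 ∘ lucasStep 4)

  d*d∣x^[2+e] : ∀ {d x} e → d ∣ x → d * d ∣ x ^ (2 + e)
  d*d∣x^[2+e] e d∣x = *-pres-∣ d∣x (∣m⇒∣m*n _ d∣x)

  4∣L⇒no-solution : ∀ {m n k r} → 4 ∣ L m → 2 ≤ n → ¬ Solution m n k r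
  4∣L⇒no-solution {m} {suc (suc n)} {k} {r} 4∣x (s≤s (s≤s _)) (solution eq) =
    L%8≢0 r (n∣m⇒m%n≡0 (L r) 8 8∣L)
    where
    8∣L : 8 ∣ L r
    8∣L = subst (8 ∣_) eq (∣-trans (divides 2 refl)
            (∣m∣n⇒∣m+n (d*d∣x^[2+e] (n + k) 4∣x) (d*d∣x^[2+e] n 4∣x)))

  times3 : ℕ → ℕ
  times3 a = 3 * a % 2889

  3^[1+e]%2889 : ∀ e → 3 ^ suc e % 2889 ≡ times3 (3 ^ e % 2889)
  3^[1+e]%2889 e = %-distribˡ-* 3 (3 ^ e) 2889

  orbit₉ orbit₂₇ : List ℕ
  orbit₉  = iterate times3 9 54
  orbit₂₇ = iterate times3 27 53

  3^[2+e]%2889∈orbit₉ : ∀ e → 3 ^ (2 + e) % 2889 ∈ orbit₉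
  3^[2+e]%2889∈orbit₉ = ∈-orbit (λ e → 3 ^ (2 + e) % 2889) (λ e → 3^[1+e]%2889 (2 + e)) 53
    where open Orbit _≟_ times3

  3^[3+e]%2889∈orbit₂₇ : ∀ e → 3 ^ (3 + e) % 2889 ∈ orbit₂₇
  3^[3+e]%2889∈orbit₂₇ = ∈-orbit (λ e → 3 ^ (3 + e) % 2889) (λ e → 3^[1+e]%2889 (3 + e)) 52
    where open Orbit _≟_ times3

  L%2889≢u+v : ∀ r {u v} → u ∈ orbit₂₇ → v ∈ orbit₉ → L r % 2889 ≢ (u + v) % 2889
  L%2889≢u+v r u∈ v∈ = lookup (lookup (sieve r) u∈) v∈
    where
    open Orbit (≡-dec _≟_ _≟_) (lucasStep 2889)
    sieve : ∀ r → All (λ u → All (λ v → L r % 2889 ≢ (u + v) % 2889) orbit₉) orbit₂₇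
    sieve = invariant (L-mod 2889) (L-mod-suc 2889) 71
              (λ s → all? (λ u → all? (λ v → ¬? (proj₁ s ≟ (u + v) % 2889)) orbit₉) orbit₂₇)

  -- k ≥ 1 is needed here: 3² + 3² = L 6.
  no-solution-m≡2 : ∀ {n k r} → 2 ≤ n → 1 ≤ k → ¬ Solution 2 n k r
  no-solution-m≡2 {suc (suc n)} {suc k} {r} (s≤s (s≤s _)) (s≤s _) (solution eq) =
    L%2889≢u+v r 3^[n+k]∈orbit₂₇ (3^[2+e]%2889∈orbit₉ n) (begin
      L r % 2889
        ≡⟨ cong (_% 2889) eq ⟨
      (3 ^ (2 + n + suc k) + 3 ^ (2 + n)) % 2889
        ≡⟨ %-distribˡ-+ (3 ^ (2 + n + suc k)) (3 ^ (2 + n)) 2889 ⟩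
      (3 ^ (2 + n + suc k) % 2889 + 3 ^ (2 + n) % 2889) % 2889
        ∎)
    where
    3^[n+k]∈orbit₂₇ : 3 ^ (2 + n + suc k) % 2889 ∈ orbit₂₇
    3^[n+k]∈orbit₂₇ =
      subst (λ e → 3 ^ (2 + e) % 2889 ∈ orbit₂₇) (sym (+-suc n k)) (3^[3+e]%2889∈orbit₂₇ (n + k))

module ℤ-Lemmas where

  open import Data.Integer using (ℤ; +_; -_; _+_; _-_; _*_; _^_; 0ℤ; 1ℤ; -1ℤ; ∣_∣; _≟_)
  open import Data.Integer.Properties
    using (pos-+; pos-*; neg-injective; *-distribʳ-+; *-assoc; *-comm; *-identityˡ; ^-distribˡ-+-*; ^-zeroˡ;
           m-n≡m⊖n; ⊖-≥)
  open import Data.Integer.Divisibility.Signed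
    using (_∣_; divides; ∣-refl; ∣-trans; ∣m∣n⇒∣m+n; ∣m⇒∣-m; ∣m+n∣m⇒∣n; ∣m⇒∣m*n; ∣n⇒∣m*n;
           ∣⇒∣ᵤ; ∣ᵤ⇒∣)
  open import Data.Integer.Tactic.RingSolver using (solve-∀)
  open import Data.Nat using (z≤n; s≤s; _%_; _/_)
  open import Data.Nat.Properties
    using (+-suc; *-suc; +-comm; +-identityʳ; +-cancelˡ-<; +-mono-≤; m<n+m; <⇒≤; <⇒≱; <-cmp; ≤-total;
           m≤n⇒∃[o]m+o≡n; m+[n∸m]≡n)
  import Data.Nat.Properties as ℕₚ
  open import Data.Nat.DivMod using (m≡m%n+[m/n]*n; m%n<n; %-remove-+ʳ)
  open import Data.Nat.Divisibility using (∣⇒≤; m%n≡0⇒n∣m)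
  import Data.Nat.Tactic.RingSolver as ℕ-Solver
  open import Relation.Binary.Bundles using (Setoid)
  import Relation.Binary.Reasoning.Setoid as SetoidReasoning
  open import Relation.Binary.Definitions using (tri<; tri≈; tri>)
  open ℕ-Lemmas

  Lᶻ : ℕ → ℤ
  Lᶻ j = + L j

  Lᶻ-rec : ∀ j → Lᶻ (suc (suc j)) ≡ Lᶻ (suc j) + Lᶻ j
  Lᶻ-rec j = pos-+ (L (suc j)) (L j)

  L-product : ∀ b a → Lᶻ b * Lᶻ (b ℕ.+ a) ≡ Lᶻ (b ℕ.+ (b ℕ.+ a)) + -1ℤ ^ b * Lᶻ a
  L-product 0 a = identity (Lᶻ a)
    where
    identity : ∀ y → + 2 * y ≡ y + 1ℤ * y
    identity = solve-∀
  L-product 1 a = trans (identity (Lᶻ (suc a)) (Lᶻ a)) (cong (_+ -1ℤ * 1ℤ * Lᶻ a) (sym (Lᶻ-rec a)))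
    where
    identity : ∀ y z → + 1 * y ≡ (y + z) + -1ℤ * 1ℤ * z
    identity = solve-∀
  -- L (2 + b) = L (1 + b) + L b splits the product into the instances (1 + b, 1 + a) and (b, 2 + a).
  L-product (suc (suc b)) a = begin
    Lᶻ (2 ℕ.+ b) * Lᶻ d
      ≡⟨ cong (_* Lᶻ d) (Lᶻ-rec b) ⟩
    (Lᶻ (1 ℕ.+ b) + Lᶻ b) * Lᶻ d
      ≡⟨ *-distribʳ-+ (Lᶻ d) (Lᶻ (1 ℕ.+ b)) (Lᶻ b) ⟩
    Lᶻ (1 ℕ.+ b) * Lᶻ d + Lᶻ b * Lᶻ d
      ≡⟨ cong₂ _+_
           (subst₂ (λ i j → Lᶻ (1 ℕ.+ b) * Lᶻ i ≡ Lᶻ j + -1ℤ * s * Lᶻ (1 ℕ.+ a))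
                   (shift₁ b a) (shift₃ b a) (L-product (suc b) (suc a)))
           (subst₂ (λ i j → Lᶻ b * Lᶻ i ≡ Lᶻ j + s * Lᶻ (2 ℕ.+ a))
                   (shift₂ b a) (shift₄ b a) (L-product b (2 ℕ.+ a))) ⟩
    (Lᶻ (3 ℕ.+ c) + -1ℤ * s * Lᶻ (1 ℕ.+ a)) + (Lᶻ (2 ℕ.+ c) + s * Lᶻ (2 ℕ.+ a))
      ≡⟨ cong (λ y → (Lᶻ (3 ℕ.+ c) + -1ℤ * s * Lᶻ (1 ℕ.+ a)) + (Lᶻ (2 ℕ.+ c) + s * y)) (Lᶻ-rec a) ⟩
    (Lᶻ (3 ℕ.+ c) + -1ℤ * s * Lᶻ (1 ℕ.+ a)) + (Lᶻ (2 ℕ.+ c) + s * (Lᶻ (1 ℕ.+ a) + Lᶻ a))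
      ≡⟨ identity (Lᶻ (3 ℕ.+ c)) (Lᶻ (2 ℕ.+ c)) (Lᶻ (1 ℕ.+ a)) (Lᶻ a) s ⟩
    (Lᶻ (3 ℕ.+ c) + Lᶻ (2 ℕ.+ c)) + -1ℤ * (-1ℤ * s) * Lᶻ a
      ≡⟨ cong (_+ -1ℤ ^ (2 ℕ.+ b) * Lᶻ a) (Lᶻ-rec (2 ℕ.+ c)) ⟨
    Lᶻ (4 ℕ.+ c) + -1ℤ ^ (2 ℕ.+ b) * Lᶻ a
      ≡⟨ cong (λ i → Lᶻ i + -1ℤ ^ (2 ℕ.+ b) * Lᶻ a) (shift₅ b a) ⟨
    Lᶻ (2 ℕ.+ b ℕ.+ d) + -1ℤ ^ (2 ℕ.+ b) * Lᶻ a
      ∎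
    where
    open ≡-Reasoning
    s : ℤ
    s = -1ℤ ^ b
    c d : ℕ
    c = b ℕ.+ (b ℕ.+ a)
    d = 2 ℕ.+ b ℕ.+ a
    identity : ∀ p q y z s → (p + -1ℤ * s * y) + (q + s * (y + z)) ≡ (p + q) + -1ℤ * (-1ℤ * s) * z
    identity = solve-∀
    shift₁ : ∀ b a → 1 ℕ.+ b ℕ.+ (1 ℕ.+ a) ≡ 2 ℕ.+ b ℕ.+ a
    shift₁ = ℕ-Solver.solve-∀
    shift₂ : ∀ b a → b ℕ.+ (2 ℕ.+ a) ≡ 2 ℕ.+ b ℕ.+ a
    shift₂ = ℕ-Solver.solve-∀
    shift₃ : ∀ b a → 1 ℕ.+ b ℕ.+ (1 ℕ.+ b ℕ.+ (1 ℕ.+ a)) ≡ 3 ℕ.+ (b ℕ.+ (b ℕ.+ a))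
    shift₃ = ℕ-Solver.solve-∀
    shift₄ : ∀ b a → b ℕ.+ (b ℕ.+ (2 ℕ.+ a)) ≡ 2 ℕ.+ (b ℕ.+ (b ℕ.+ a))
    shift₄ = ℕ-Solver.solve-∀
    shift₅ : ∀ b a → 2 ℕ.+ b ℕ.+ (2 ℕ.+ b ℕ.+ a) ≡ 4 ℕ.+ (b ℕ.+ (b ℕ.+ a))
    shift₅ = ℕ-Solver.solve-∀

  -1^[h+h]≡1 : ∀ h → -1ℤ ^ (h ℕ.+ h) ≡ 1ℤ
  -1^[h+h]≡1 zero    = refl
  -1^[h+h]≡1 (suc h) = begin
    -1ℤ * -1ℤ ^ (h ℕ.+ suc h)       ≡⟨ cong (λ e → -1ℤ * -1ℤ ^ e) (+-suc h h) ⟩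
    -1ℤ * (-1ℤ * -1ℤ ^ (h ℕ.+ h))   ≡⟨ cong (λ s → -1ℤ * (-1ℤ * s)) (-1^[h+h]≡1 h) ⟩
    1ℤ                              ∎
    where open ≡-Reasoning

  -1^[1+h+h]≡-1 : ∀ h → -1ℤ ^ suc (h ℕ.+ h) ≡ -1ℤ
  -1^[1+h+h]≡-1 h = cong (-1ℤ *_) (-1^[h+h]≡1 h)

  ∣-cancel-sign : ∀ {d a c} b → d ∣ a + -1ℤ ^ b * c → d ∣ a → d ∣ c
  ∣-cancel-sign {d} {a} {c} b d∣a+sc d∣a =
    subst (d ∣_) s*[s*c]≡c (∣n⇒∣m*n (-1ℤ ^ b) (∣m+n∣m⇒∣n d∣a+sc d∣a))
    where
    s*[s*c]≡c : -1ℤ ^ b * (-1ℤ ^ b * c) ≡ c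
    s*[s*c]≡c = begin
      -1ℤ ^ b * (-1ℤ ^ b * c)     ≡⟨ *-assoc (-1ℤ ^ b) (-1ℤ ^ b) c ⟨
      -1ℤ ^ b * -1ℤ ^ b * c       ≡⟨ cong (_* c) (^-distribˡ-+-* -1ℤ b b) ⟨
      -1ℤ ^ (b ℕ.+ b) * c         ≡⟨ cong (_* c) (-1^[h+h]≡1 b) ⟩
      1ℤ * c                      ≡⟨ *-identityˡ c ⟩
      c                           ∎
      where open ≡-Reasoning

  Lᶻ∤Lᶻ[<] : ∀ {i j} → 2 ℕ.≤ j → i ℕ.< j → ¬ Lᶻ j ∣ Lᶻ i
  Lᶻ∤Lᶻ[<] {i} 2≤j i<j j∣i =
    <⇒≱ (L-mono-< 2≤j i<j) (∣⇒≤ {{ℕ.>-nonZero (L-pos i)}} (∣⇒∣ᵤ j∣i))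

  Lᶻ∣Lᶻ[m+[m+a]]⇒Lᶻ∣Lᶻ[a] : ∀ m a → Lᶻ m ∣ Lᶻ (m ℕ.+ (m ℕ.+ a)) → Lᶻ m ∣ Lᶻ a
  Lᶻ∣Lᶻ[m+[m+a]]⇒Lᶻ∣Lᶻ[a] m a =
    ∣-cancel-sign m (divides (Lᶻ (m ℕ.+ a)) (trans (sym (L-product m a)) (*-comm (Lᶻ m) _)))

  Lᶻ∤Lᶻ[m+u] : ∀ {m u} → 0 ℕ.< u → u ℕ.< m → ¬ Lᶻ m ∣ Lᶻ (m ℕ.+ u)
  Lᶻ∤Lᶻ[m+u] {u = u} 0<u u<m m∣m+u with m≤n⇒∃[o]m+o≡n (<⇒≤ u<m)
  ... | v , refl = Lᶻ∤Lᶻ[<] 2≤u+v v<u+v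
    (∣-cancel-sign u (divides (Lᶻ u) (sym (L-product u v)))
      (subst (λ i → Lᶻ (u ℕ.+ v) ∣ Lᶻ i) (+-comm (u ℕ.+ v) u) m∣m+u))
    where
    0<v : 0 ℕ.< v
    0<v = m<m+n⇒0<n u u<m
    2≤u+v : 2 ℕ.≤ u ℕ.+ v
    2≤u+v = +-mono-≤ 0<u 0<v
    v<u+v : v ℕ.< u ℕ.+ v
    v<u+v = m<n+m v 0<u

  Lᶻ∣Lᶻ[ρ]⇒ρ≡m : ∀ {m ρ} → 2 ℕ.≤ m → ρ ℕ.< m ℕ.+ m → Lᶻ m ∣ Lᶻ ρ → ρ ≡ m
  Lᶻ∣Lᶻ[ρ]⇒ρ≡m {m} {ρ} 2≤m ρ<2m m∣ρ with <-cmp ρ m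
  ... | tri< ρ<m _ _ = contradiction m∣ρ (Lᶻ∤Lᶻ[<] 2≤m ρ<m)
  ... | tri≈ _ ρ≡m _ = ρ≡m
  ... | tri> _ _ m<ρ with m≤n⇒∃[o]m+o≡n (<⇒≤ m<ρ)
  ...   | u , refl = contradiction m∣ρ (Lᶻ∤Lᶻ[m+u] (m<m+n⇒0<n m m<ρ) (+-cancelˡ-< m u m ρ<2m))

  Lᶻ∣Lᶻ[ρ+Q*2m]⇒Lᶻ∣Lᶻ[ρ] : ∀ m ρ Q → Lᶻ m ∣ Lᶻ (ρ ℕ.+ Q ℕ.* (m ℕ.+ m)) → Lᶻ m ∣ Lᶻ ρ
  Lᶻ∣Lᶻ[ρ+Q*2m]⇒Lᶻ∣Lᶻ[ρ] m ρ zero    = subst (λ i → Lᶻ m ∣ Lᶻ i) (+-identityʳ ρ)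
  Lᶻ∣Lᶻ[ρ+Q*2m]⇒Lᶻ∣Lᶻ[ρ] m ρ (suc Q) =
    Lᶻ∣Lᶻ[ρ+Q*2m]⇒Lᶻ∣Lᶻ[ρ] m ρ Q ∘ Lᶻ∣Lᶻ[m+[m+a]]⇒Lᶻ∣Lᶻ[a] m _
      ∘ subst (λ i → Lᶻ m ∣ Lᶻ i) (shift m ρ Q)
    where
    shift : ∀ m ρ Q →
            ρ ℕ.+ (m ℕ.+ m ℕ.+ Q ℕ.* (m ℕ.+ m)) ≡ m ℕ.+ (m ℕ.+ (ρ ℕ.+ Q ℕ.* (m ℕ.+ m)))
    shift = ℕ-Solver.solve-∀

  Lᶻ∣Lᶻ⇒odd-multiple : ∀ {m r} → 2 ℕ.≤ m → Lᶻ m ∣ Lᶻ r → ∃[ q ] r ≡ m ℕ.* suc (q ℕ.+ q)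
  Lᶻ∣Lᶻ⇒odd-multiple {m} {r} 2≤m@(s≤s (s≤s _)) m∣r = Q , (begin
    r                           ≡⟨ m≡m%n+[m/n]*n r (m ℕ.+ m) ⟩
    ρ ℕ.+ Q ℕ.* (m ℕ.+ m)       ≡⟨ cong (ℕ._+ Q ℕ.* (m ℕ.+ m)) ρ≡m ⟩
    m ℕ.+ Q ℕ.* (m ℕ.+ m)       ≡⟨ odd-multiple m Q ⟩
    m ℕ.* suc (Q ℕ.+ Q)         ∎)
    where
    open ≡-Reasoning
    ρ Q : ℕ
    ρ = r % (m ℕ.+ m)
    Q = r / (m ℕ.+ m)
    ρ≡m : ρ ≡ m
    ρ≡m = Lᶻ∣Lᶻ[ρ]⇒ρ≡m 2≤m (m%n<n r (m ℕ.+ m)) (Lᶻ∣Lᶻ[ρ+Q*2m]⇒Lᶻ∣Lᶻ[ρ] m ρ Q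
            (subst (λ i → Lᶻ m ∣ Lᶻ i) (m≡m%n+[m/n]*n r (m ℕ.+ m)) m∣r))
    odd-multiple : ∀ m Q → m ℕ.+ Q ℕ.* (m ℕ.+ m) ≡ m ℕ.* suc (Q ℕ.+ Q)
    odd-multiple = ℕ-Solver.solve-∀

  infix 4 _≡_mod_

  record _≡_mod_ (a b n : ℤ) : Set where
    constructor ∣⇒≡mod
    field ≡mod⇒∣ : n ∣ a - b

  open _≡_mod_

  module _ {n : ℤ} where

    ≡⇒≡-mod : ∀ {a b} → a ≡ b → a ≡ b mod n
    ≡⇒≡-mod {a} refl = ∣⇒≡mod (divides 0ℤ (a-a≡0*n a n))
      where
      a-a≡0*n : ∀ a n → a - a ≡ 0ℤ * n
      a-a≡0*n = solve-∀

    mod-refl : ∀ {a} → a ≡ a mod n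
    mod-refl = ≡⇒≡-mod refl

    mod-sym : ∀ {a b} → a ≡ b mod n → b ≡ a mod n
    mod-sym {a} {b} (∣⇒≡mod n∣a-b) = ∣⇒≡mod (subst (n ∣_) (identity a b) (∣m⇒∣-m n∣a-b))
      where
      identity : ∀ a b → - (a - b) ≡ b - a
      identity = solve-∀

    mod-trans : ∀ {a b c} → a ≡ b mod n → b ≡ c mod n → a ≡ c mod n
    mod-trans {a} {b} {c} (∣⇒≡mod n∣a-b) (∣⇒≡mod n∣b-c) =
      ∣⇒≡mod (subst (n ∣_) (identity a b c) (∣m∣n⇒∣m+n n∣a-b n∣b-c))
      where
      identity : ∀ a b c → (a - b) + (b - c) ≡ a - c
      identity = solve-∀

    mod-+ : ∀ {a b c d} → a ≡ b mod n → c ≡ d mod n → a + c ≡ b + d mod n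
    mod-+ {a} {b} {c} {d} (∣⇒≡mod n∣a-b) (∣⇒≡mod n∣c-d) =
      ∣⇒≡mod (subst (n ∣_) (identity a b c d) (∣m∣n⇒∣m+n n∣a-b n∣c-d))
      where
      identity : ∀ a b c d → (a - b) + (c - d) ≡ (a + c) - (b + d)
      identity = solve-∀

    mod-neg : ∀ {a b} → a ≡ b mod n → - a ≡ - b mod n
    mod-neg {a} {b} (∣⇒≡mod n∣a-b) = ∣⇒≡mod (subst (n ∣_) (identity a b) (∣m⇒∣-m n∣a-b))
      where
      identity : ∀ a b → - (a - b) ≡ - a - - b
      identity = solve-∀

    mod-* : ∀ {a b c d} → a ≡ b mod n → c ≡ d mod n → a * c ≡ b * d mod n
    mod-* {a} {b} {c} {d} (∣⇒≡mod n∣a-b) (∣⇒≡mod n∣c-d) =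
      ∣⇒≡mod (subst (n ∣_) (identity a b c d) (∣m∣n⇒∣m+n (∣m⇒∣m*n c n∣a-b) (∣n⇒∣m*n b n∣c-d)))
      where
      identity : ∀ a b c d → (a - b) * c + b * (c - d) ≡ a * c - b * d
      identity = solve-∀

    mod-^ : ∀ {a b} → a ≡ b mod n → ∀ e → a ^ e ≡ b ^ e mod n
    mod-^ a≡b zero    = mod-refl
    mod-^ a≡b (suc e) = mod-* a≡b (mod-^ a≡b e)

  mod-∣ : ∀ {d n a b} → d ∣ n → a ≡ b mod n → a ≡ b mod d
  mod-∣ d∣n (∣⇒≡mod n∣a-b) = ∣⇒≡mod (∣-trans d∣n n∣a-b)

  mod-setoid : ℤ → Setoid _ _
  mod-setoid n = record
    { Carrier       = ℤ
    ; _≈_           = λ a b → a ≡ b mod n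
    ; isEquivalence = record { refl = mod-refl ; sym = mod-sym ; trans = mod-trans }
    }

  %≡⇒mod : ∀ {a b n} .{{_ : ℕ.NonZero n}} → a % n ≡ b → + a ≡ + b mod + n
  %≡⇒mod {a} {n = n} refl = ∣⇒≡mod (divides (+ (a / n)) (begin
    + a - + (a % n)                              ≡⟨ cong (λ i → + i - + (a % n)) (m≡m%n+[m/n]*n a n) ⟩
    + (a % n ℕ.+ a / n ℕ.* n) - + (a % n)        ≡⟨ cong (_- + (a % n)) (pos-+ (a % n) (a / n ℕ.* n)) ⟩
    + (a % n) + + (a / n ℕ.* n) - + (a % n)      ≡⟨ identity (+ (a % n)) (+ (a / n ℕ.* n)) ⟩
    + (a / n ℕ.* n)                              ≡⟨ pos-* (a / n) n ⟩
    + (a / n) * + n                              ∎))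
    where
    open ≡-Reasoning
    identity : ∀ x y → x + y - x ≡ y
    identity = solve-∀

  mod⇒%≡ : ∀ {a b n} .{{_ : ℕ.NonZero n}} → + a ≡ + b mod + n → a % n ≡ b % n
  mod⇒%≡ {a} {b} a≡b =
    [ (λ b≤a → %≡-of-≤ b≤a a≡b) , (λ a≤b → sym (%≡-of-≤ a≤b (mod-sym a≡b))) ]′ (≤-total b a)
    where
    %≡-of-≤ : ∀ {a b n} .{{_ : ℕ.NonZero n}} → b ℕ.≤ a → + a ≡ + b mod + n → a % n ≡ b % n
    %≡-of-≤ {a} {b} {n} b≤a a≡b = begin
      a % n                   ≡⟨ cong (_% n) (m+[n∸m]≡n b≤a) ⟨
      (b ℕ.+ (a ℕ.∸ b)) % n   ≡⟨ %-remove-+ʳ b (∣⇒∣ᵤ n∣a∸b) ⟩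
      b % n                   ∎
      where
      open ≡-Reasoning
      n∣a∸b : + n ∣ + (a ℕ.∸ b)
      n∣a∸b = subst (+ n ∣_) (trans (m-n≡m⊖n a b) (⊖-≥ b≤a)) (≡mod⇒∣ a≡b)

  ∣⇒∣∣≤∣∣ : ∀ {n d} → n ∣ d → 0 ℕ.< ∣ d ∣ → ∣ n ∣ ℕ.≤ ∣ d ∣
  ∣⇒∣∣≤∣∣ n∣d 0<∣d∣ = ∣⇒≤ {{ℕ.>-nonZero 0<∣d∣}} (∣⇒∣ᵤ n∣d)

  Lᶻ[1+2q]≢2-mod-4 : ∀ q → ¬ (Lᶻ (suc (q ℕ.+ q)) ≡ + 2 mod + 4)
  Lᶻ[1+2q]≢2-mod-4 q = L[1+2q]%4≢2 q ∘ mod⇒%≡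

  V : ℤ → ℤ → ℕ → ℤ
  V P Q 0             = + 2
  V P Q 1             = P
  V P Q (suc (suc j)) = P * V P Q (suc j) - Q * V P Q j

  Lᶻ[m*j]≡V : ∀ m j → Lᶻ (m ℕ.* j) ≡ V (Lᶻ m) (-1ℤ ^ m) j
  Lᶻ[m*j]≡V m 0             = cong Lᶻ (ℕₚ.*-zeroʳ m)
  Lᶻ[m*j]≡V m 1             = cong Lᶻ (ℕₚ.*-identityʳ m)
  Lᶻ[m*j]≡V m (suc (suc j)) = begin
    Lᶻ (m ℕ.* suc (suc j))
      ≡⟨ cong Lᶻ (trans (*-suc m (suc j)) (cong (m ℕ.+_) (*-suc m j))) ⟩
    Lᶻ (m ℕ.+ (m ℕ.+ m ℕ.* j))
      ≡⟨ isolate (L-product m (m ℕ.* j)) ⟩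
    Lᶻ m * Lᶻ (m ℕ.+ m ℕ.* j) - s * Lᶻ (m ℕ.* j)
      ≡⟨ cong (λ i → Lᶻ m * Lᶻ i - s * Lᶻ (m ℕ.* j)) (*-suc m j) ⟨
    Lᶻ m * Lᶻ (m ℕ.* suc j) - s * Lᶻ (m ℕ.* j)
      ≡⟨ cong₂ (λ y z → Lᶻ m * y - s * z) (Lᶻ[m*j]≡V m (suc j)) (Lᶻ[m*j]≡V m j) ⟩
    V (Lᶻ m) s (suc (suc j))
      ∎
    where
    open ≡-Reasoning
    s : ℤ
    s = -1ℤ ^ m
    isolate : ∀ {x y z} → x ≡ y + z → y ≡ x - z
    isolate {x} {y} {z} x≡y+z = trans (identity y z) (cong (_- z) (sym x≡y+z))
      where
      identity : ∀ y z → y ≡ y + z - z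
      identity = solve-∀

  V-mod : ∀ {N P Q} (v : ℕ → ℤ) → + 2 ≡ v 0 mod N → P ≡ v 1 mod N →
          (∀ j → P * v (suc j) - Q * v j ≡ v (suc (suc j)) mod N) → ∀ j → V P Q j ≡ v j mod N
  V-mod v v₀ v₁ v-rec 0             = v₀
  V-mod v v₀ v₁ v-rec 1             = v₁
  V-mod {P = P} {Q} v v₀ v₁ v-rec (suc (suc j)) = mod-trans
    (mod-+ (mod-* (mod-refl {a = P}) (V-mod v v₀ v₁ v-rec (suc j)))
           (mod-neg (mod-* (mod-refl {a = Q}) (V-mod v v₀ v₁ v-rec j))))
    (v-rec j)

  V-cong : ∀ {N P P′ Q} → P ≡ P′ mod N → ∀ j → V P Q j ≡ V P′ Q j mod N
  V-cong P≡P′ = V-mod _ mod-refl P≡P′ (λ j → mod-+ (mod-* P≡P′ mod-refl) mod-refl)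

  V[1,-1]≡Lᶻ : ∀ j → V 1ℤ -1ℤ j ≡ Lᶻ j
  V[1,-1]≡Lᶻ 0             = refl
  V[1,-1]≡Lᶻ 1             = refl
  V[1,-1]≡Lᶻ (suc (suc j)) = begin
    1ℤ * V 1ℤ -1ℤ (suc j) - -1ℤ * V 1ℤ -1ℤ j
      ≡⟨ cong₂ (λ y z → 1ℤ * y - -1ℤ * z) (V[1,-1]≡Lᶻ (suc j)) (V[1,-1]≡Lᶻ j) ⟩
    1ℤ * Lᶻ (suc j) - -1ℤ * Lᶻ j
      ≡⟨ identity (Lᶻ (suc j)) (Lᶻ j) ⟩
    Lᶻ (suc j) + Lᶻ j
      ≡⟨ Lᶻ-rec j ⟨
    Lᶻ (suc (suc j))
      ∎
    where
    open ≡-Reasoning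
    identity : ∀ y z → 1ℤ * y - -1ℤ * z ≡ y + z
    identity = solve-∀

  V[-1,-1]≡±Lᶻ : ∀ j → V -1ℤ -1ℤ j ≡ -1ℤ ^ j * Lᶻ j
  V[-1,-1]≡±Lᶻ 0             = refl
  V[-1,-1]≡±Lᶻ 1             = refl
  V[-1,-1]≡±Lᶻ (suc (suc j)) = begin
    -1ℤ * V -1ℤ -1ℤ (suc j) - -1ℤ * V -1ℤ -1ℤ j
      ≡⟨ cong₂ (λ y z → -1ℤ * y - -1ℤ * z) (V[-1,-1]≡±Lᶻ (suc j)) (V[-1,-1]≡±Lᶻ j) ⟩
    -1ℤ * (-1ℤ * s * Lᶻ (suc j)) - -1ℤ * (s * Lᶻ j)
      ≡⟨ identity s (Lᶻ (suc j)) (Lᶻ j) ⟩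
    -1ℤ * (-1ℤ * s) * (Lᶻ (suc j) + Lᶻ j)
      ≡⟨ cong (-1ℤ * (-1ℤ * s) *_) (Lᶻ-rec j) ⟨
    -1ℤ * (-1ℤ * s) * Lᶻ (suc (suc j))
      ∎
    where
    open ≡-Reasoning
    s : ℤ
    s = -1ℤ ^ j
    identity : ∀ s y z → -1ℤ * (-1ℤ * s * y) - -1ℤ * (s * z) ≡ -1ℤ * (-1ℤ * s) * (y + z)
    identity = solve-∀

  pos-^ : ∀ x e → + (x ℕ.^ e) ≡ (+ x) ^ e
  pos-^ x zero    = refl
  pos-^ x (suc e) = trans (pos-* x (x ℕ.^ e)) (cong ((+ x) *_) (pos-^ x e))

  V-solution : ∀ {N m n k t} {p : ℕ → ℤ} → (∀ e → Lᶻ m ^ e ≡ p e mod N) →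
               Solution m n k (m ℕ.* t) → V (Lᶻ m) (-1ℤ ^ m) t ≡ p (n ℕ.+ k) + p n mod N
  V-solution {N} {m} {n} {k} {t} {p} x^e≡p (solution eq) = begin
    V (Lᶻ m) (-1ℤ ^ m) t                      ≡⟨ Lᶻ[m*j]≡V m t ⟨
    Lᶻ (m ℕ.* t)                              ≡⟨ cong +_ eq ⟨
    + (L m ℕ.^ (n ℕ.+ k) ℕ.+ L m ℕ.^ n)       ≡⟨ pos-+ (L m ℕ.^ (n ℕ.+ k)) (L m ℕ.^ n) ⟩
    + (L m ℕ.^ (n ℕ.+ k)) + + (L m ℕ.^ n)     ≡⟨ cong₂ _+_ (pos-^ (L m) (n ℕ.+ k)) (pos-^ (L m) n) ⟩
    Lᶻ m ^ (n ℕ.+ k) + Lᶻ m ^ n               ≈⟨ mod-+ (x^e≡p (n ℕ.+ k)) (x^e≡p n) ⟩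
    p (n ℕ.+ k) + p n                         ∎
    where open SetoidReasoning (mod-setoid N)

  V-step : ℤ → ℤ → ℤ × ℤ → ℤ × ℤ
  V-step P Q (a , b) = b , P * b - Q * a

  V-pair : ℤ → ℤ → ℕ → ℤ × ℤ
  V-pair P Q j = V P Q j , V P Q (suc j)

  0<∣V[1,1,1+2q]-2∣<6 : ∀ q → 0 ℕ.< ∣ V 1ℤ 1ℤ (suc (q ℕ.+ q)) - + 2 ∣
                             × ∣ V 1ℤ 1ℤ (suc (q ℕ.+ q)) - + 2 ∣ ℕ.< 6
  0<∣V[1,1,1+2q]-2∣<6 =
    invariant (λ q → V-pair 1ℤ 1ℤ (suc (q ℕ.+ q)))
      (odd-subsequence (V-step 1ℤ 1ℤ) (V-pair 1ℤ 1ℤ) (λ _ → refl)) 2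
      (λ s → (0 ℕ.<? ∣ proj₁ s - + 2 ∣) ×-dec (∣ proj₁ s - + 2 ∣ ℕ.<? 6))
    where open Orbit (≡-dec _≟_ _≟_) (V-step 1ℤ 1ℤ ∘ V-step 1ℤ 1ℤ)

  1+c≤x⇒c≤∣x-1∣ : ∀ {c x} → suc c ℕ.≤ x → c ℕ.≤ ∣ + x - 1ℤ ∣
  1+c≤x⇒c≤∣x-1∣ (s≤s c≤x-1) = c≤x-1

  solution⇒V≡2-mod-L-1 : ∀ {m n k t} → Solution m n k (m ℕ.* t) →
                         V 1ℤ (-1ℤ ^ m) t ≡ + 2 mod (Lᶻ m - 1ℤ)
  solution⇒V≡2-mod-L-1 {m} {n} {k} {t} sol = begin
    V 1ℤ (-1ℤ ^ m) t               ≈⟨ V-cong (mod-sym x≡1) t ⟩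
    V (Lᶻ m) (-1ℤ ^ m) t           ≈⟨ V-solution (mod-^ x≡1) sol ⟩
    1ℤ ^ (n ℕ.+ k) + 1ℤ ^ n        ≡⟨ cong₂ _+_ (^-zeroˡ (n ℕ.+ k)) (^-zeroˡ n) ⟩
    + 2                            ∎
    where
    open SetoidReasoning (mod-setoid (Lᶻ m - 1ℤ))
    x≡1 : Lᶻ m ≡ 1ℤ mod (Lᶻ m - 1ℤ)
    x≡1 = ∣⇒≡mod ∣-refl

  no-solution-even : ∀ {m n k} q → -1ℤ ^ m ≡ 1ℤ → 7 ℕ.≤ L m →
                     ¬ Solution m n k (m ℕ.* suc (q ℕ.+ q))
  no-solution-even {m} q sign 7≤x sol =
    <⇒≱ ∣d∣<6 (ℕₚ.≤-trans (1+c≤x⇒c≤∣x-1∣ 7≤x) (∣⇒∣∣≤∣∣ (≡mod⇒∣ V≡2) 0<∣d∣))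
    where
    t : ℕ
    t = suc (q ℕ.+ q)
    V≡2 : V 1ℤ 1ℤ t ≡ + 2 mod (Lᶻ m - 1ℤ)
    V≡2 = subst (λ σ → V 1ℤ σ t ≡ + 2 mod (Lᶻ m - 1ℤ)) sign (solution⇒V≡2-mod-L-1 sol)
    0<∣d∣ : 0 ℕ.< ∣ V 1ℤ 1ℤ t - + 2 ∣
    0<∣d∣ = proj₁ (0<∣V[1,1,1+2q]-2∣<6 q)
    ∣d∣<6 : ∣ V 1ℤ 1ℤ t - + 2 ∣ ℕ.< 6
    ∣d∣<6 = proj₂ (0<∣V[1,1,1+2q]-2∣<6 q)

  no-solution-L≡1-mod-4 : ∀ {m n k} q → -1ℤ ^ m ≡ -1ℤ → Lᶻ m ≡ 1ℤ mod + 4 →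
                          ¬ Solution m n k (m ℕ.* suc (q ℕ.+ q))
  no-solution-L≡1-mod-4 {m} q sign x≡1[4] sol =
    Lᶻ[1+2q]≢2-mod-4 q (mod-∣ (≡mod⇒∣ x≡1[4]) L≡2)
    where
    t : ℕ
    t = suc (q ℕ.+ q)
    L≡2 : Lᶻ t ≡ + 2 mod (Lᶻ m - 1ℤ)
    L≡2 = subst (λ y → y ≡ + 2 mod (Lᶻ m - 1ℤ)) (V[1,-1]≡Lᶻ t)
            (subst (λ σ → V 1ℤ σ t ≡ + 2 mod (Lᶻ m - 1ℤ)) sign (solution⇒V≡2-mod-L-1 sol))

  ℤ[i] : Set
  ℤ[i] = ℤ × ℤ

  times-i : ℤ[i] → ℤ[i]
  times-i (a , b) = - b , a

  _⊕_ _⊖_ : ℤ[i] → ℤ[i] → ℤ[i]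
  (a , b) ⊕ (c , d) = a + c , b + d
  (a , b) ⊖ (c , d) = a - c , b - d

  i^ : ℕ → ℤ[i]
  i^ zero    = 1ℤ , 0ℤ
  i^ (suc e) = times-i (i^ e)

  -- ω j = V_j(i, -1), which is what V_j(X, -1) becomes modulo X² + 1.
  ω : ℕ → ℤ[i]
  ω 0             = + 2 , 0ℤ
  ω 1             = 0ℤ , 1ℤ
  ω (suc (suc j)) = times-i (ω (suc j)) ⊕ ω j

  eval : ℤ → ℤ[i] → ℤ
  eval X (a , b) = a + b * X

  norm : ℤ[i] → ℤ
  norm (a , b) = a * a + b * b

  eval-times-i : ∀ X z → eval X (times-i z) ≡ X * eval X z mod X * X + 1ℤ
  eval-times-i X (a , b) = ∣⇒≡mod (divides (- b) (identity X a b))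
    where
    identity : ∀ X a b → (- b + a * X) - X * (a + b * X) ≡ - b * (X * X + 1ℤ)
    identity = solve-∀

  eval-⊕ : ∀ X z w → eval X (z ⊕ w) ≡ eval X z + eval X w
  eval-⊕ X (a , b) (c , d) = identity X a b c d
    where
    identity : ∀ X a b c d → (a + c) + (b + d) * X ≡ (a + b * X) + (c + d * X)
    identity = solve-∀

  eval-⊖ : ∀ X z w → eval X (z ⊖ w) ≡ eval X z - eval X w
  eval-⊖ X (a , b) (c , d) = identity X a b c d
    where
    identity : ∀ X a b c d → (a - c) + (b - d) * X ≡ (a + b * X) - (c + d * X)
    identity = solve-∀

  X^e≡eval-i^e : ∀ X e → X ^ e ≡ eval X (i^ e) mod X * X + 1ℤ
  X^e≡eval-i^e X zero    = ≡⇒≡-mod (identity X)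
    where
    identity : ∀ X → 1ℤ ≡ 1ℤ + 0ℤ * X
    identity = solve-∀
  X^e≡eval-i^e X (suc e) =
    mod-trans (mod-* (mod-refl {a = X}) (X^e≡eval-i^e X e)) (mod-sym (eval-times-i X (i^ e)))

  V[X,-1]≡eval-ω : ∀ X j → V X -1ℤ j ≡ eval X (ω j) mod X * X + 1ℤ
  V[X,-1]≡eval-ω X = V-mod (eval X ∘ ω) (≡⇒≡-mod (two X)) (≡⇒≡-mod (one X)) recurrence
    where
    two : ∀ X → + 2 ≡ + 2 + 0ℤ * X
    two = solve-∀
    one : ∀ X → X ≡ 0ℤ + 1ℤ * X
    one = solve-∀
    recurrence : ∀ j → X * eval X (ω (suc j)) - -1ℤ * eval X (ω j)
                       ≡ eval X (ω (suc (suc j))) mod X * X + 1ℤ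
    recurrence j = begin
      X * eval X (ω (suc j)) - -1ℤ * eval X (ω j)     ≡⟨ identity X (eval X (ω (suc j))) (eval X (ω j)) ⟩
      X * eval X (ω (suc j)) + eval X (ω j)           ≈⟨ mod-+ (mod-sym (eval-times-i X (ω (suc j)))) mod-refl ⟩
      eval X (times-i (ω (suc j))) + eval X (ω j)     ≡⟨ eval-⊕ X (times-i (ω (suc j))) (ω j) ⟨
      eval X (ω (suc (suc j)))                        ∎
      where
      open SetoidReasoning (mod-setoid (X * X + 1ℤ))
      identity : ∀ X y z → X * y - -1ℤ * z ≡ X * y + z
      identity = solve-∀

  ∣eval⇒∣norm : ∀ X z → X * X + 1ℤ ∣ eval X z → X * X + 1ℤ ∣ norm z
  ∣eval⇒∣norm X (a , b) N∣eval =
    subst (X * X + 1ℤ ∣_) (identity X a b)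
      (∣m∣n⇒∣m+n (∣m⇒∣m*n (a - b * X) N∣eval) (∣n⇒∣m*n (b * b) ∣-refl))
    where
    identity : ∀ X a b → (a + b * X) * (a - b * X) + b * b * (X * X + 1ℤ) ≡ a * a + b * b
    identity = solve-∀

  re[i^e]≡0⇒-1^e≡-1 : ∀ e → proj₁ (i^ e) ≡ 0ℤ → -1ℤ ^ e ≡ -1ℤ
  re[i^e]≡0⇒-1^e≡-1 0             ()
  re[i^e]≡0⇒-1^e≡-1 1             _     = refl
  re[i^e]≡0⇒-1^e≡-1 (suc (suc e)) re≡0 =
    cong (λ s → -1ℤ * (-1ℤ * s)) (re[i^e]≡0⇒-1^e≡-1 e (neg-injective re≡0))

  _≟ᵢ_ : DecidableEquality ℤ[i]
  _≟ᵢ_ = ≡-dec _≟_ _≟_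

  i^-orbit : List ℤ[i]
  i^-orbit = iterate times-i (1ℤ , 0ℤ) 4

  i^∈i^-orbit : ∀ e → i^ e ∈ i^-orbit
  i^∈i^-orbit = ∈-orbit i^ (λ _ → refl) 3
    where open Orbit _≟ᵢ_ times-i

  ω-step : ℤ[i] × ℤ[i] → ℤ[i] × ℤ[i]
  ω-step (z , w) = w , times-i w ⊕ z

  ω-pair : ℕ → ℤ[i] × ℤ[i]
  ω-pair j = ω j , ω (suc j)

  ImaginaryOrSmallNorm : ℤ[i] → ℤ[i] → ℤ[i] → Set
  ImaginaryOrSmallNorm w a b =
    (proj₁ a ≡ 0ℤ × proj₁ b ≡ 0ℤ) ⊎ (0 ℕ.< ∣ norm (w ⊖ (a ⊕ b)) ∣ × ∣ norm (w ⊖ (a ⊕ b)) ∣ ℕ.< 50)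

  imaginary-or-small-norm : ∀ q e e′ → ImaginaryOrSmallNorm (ω (suc (q ℕ.+ q))) (i^ e) (i^ e′)
  imaginary-or-small-norm q e e′ = lookup (lookup (table q) (i^∈i^-orbit e)) (i^∈i^-orbit e′)
    where
    open Orbit (≡-dec _≟ᵢ_ _≟ᵢ_) (ω-step ∘ ω-step)
    decide : ∀ w a b → Dec (ImaginaryOrSmallNorm w a b)
    decide w a b = ((proj₁ a ≟ 0ℤ) ×-dec (proj₁ b ≟ 0ℤ))
      ⊎-dec ((0 ℕ.<? ∣ norm (w ⊖ (a ⊕ b)) ∣) ×-dec (∣ norm (w ⊖ (a ⊕ b)) ∣ ℕ.<? 50))
    table : ∀ q → All (λ a → All (ImaginaryOrSmallNorm (ω (suc (q ℕ.+ q))) a) i^-orbit) i^-orbit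
    table = invariant (λ q → ω-pair (suc (q ℕ.+ q))) (odd-subsequence ω-step ω-pair (λ _ → refl)) 5
              (λ s → all? (λ a → all? (decide (proj₁ s) a) i^-orbit) i^-orbit)

  -- ω t - (i^(n+k) + i^n) is divisible by x² + 1 ≥ 50 and has norm below 50, so it vanishes,
  -- which forces i^(n+k) and i^n to be purely imaginary.
  solution⇒odd-exponents : ∀ {m n k} q → -1ℤ ^ m ≡ -1ℤ → 7 ℕ.≤ L m →
                           Solution m n k (m ℕ.* suc (q ℕ.+ q)) →
                           -1ℤ ^ (n ℕ.+ k) ≡ -1ℤ × -1ℤ ^ n ≡ -1ℤ
  solution⇒odd-exponents {m} {n} {k} q sign 7≤x sol =
    [ (λ (re≡0 , re′≡0) → re[i^e]≡0⇒-1^e≡-1 (n ℕ.+ k) re≡0 , re[i^e]≡0⇒-1^e≡-1 n re′≡0)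
    , (λ (0<∣norm∣ , ∣norm∣<50) →
         contradiction (ℕₚ.≤-trans 50≤∣N∣ (∣⇒∣∣≤∣∣ N∣norm 0<∣norm∣)) (<⇒≱ ∣norm∣<50))
    ]′ (imaginary-or-small-norm q (n ℕ.+ k) n)
    where
    t : ℕ
    t = suc (q ℕ.+ q)
    X N : ℤ
    X = Lᶻ m
    N = X * X + 1ℤ
    d : ℤ[i]
    d = ω t ⊖ (i^ (n ℕ.+ k) ⊕ i^ n)
    ω≡ : eval X (ω t) ≡ eval X (i^ (n ℕ.+ k)) + eval X (i^ n) mod N
    ω≡ = begin
      eval X (ω t)                             ≈⟨ mod-sym (V[X,-1]≡eval-ω X t) ⟩
      V X -1ℤ t                                ≡⟨ cong (λ σ → V X σ t) sign ⟨
      V X (-1ℤ ^ m) t                          ≈⟨ V-solution (X^e≡eval-i^e X) sol ⟩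
      eval X (i^ (n ℕ.+ k)) + eval X (i^ n)    ∎
      where open SetoidReasoning (mod-setoid N)
    eval-d : eval X (ω t) - (eval X (i^ (n ℕ.+ k)) + eval X (i^ n)) ≡ eval X d
    eval-d = sym (trans (eval-⊖ X (ω t) (i^ (n ℕ.+ k) ⊕ i^ n))
                        (cong (λ y → eval X (ω t) - y) (eval-⊕ X (i^ (n ℕ.+ k)) (i^ n))))
    N∣norm : N ∣ norm d
    N∣norm = ∣eval⇒∣norm X d (subst (N ∣_) eval-d (≡mod⇒∣ ω≡))
    50≤∣N∣ : 50 ℕ.≤ ∣ N ∣
    50≤∣N∣ = subst (λ i → 50 ℕ.≤ ∣ i ∣)
               (trans (pos-+ (L m ℕ.* L m) 1) (cong (_+ 1ℤ) (pos-* (L m) (L m))))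
               (ℕₚ.+-monoˡ-≤ 1 (ℕₚ.*-mono-≤ 7≤x 7≤x))

  no-solution-L≡-1-mod-4 : ∀ {m n k} q → -1ℤ ^ m ≡ -1ℤ → Lᶻ m ≡ -1ℤ mod + 4 → 7 ℕ.≤ L m →
                           ¬ Solution m n k (m ℕ.* suc (q ℕ.+ q))
  no-solution-L≡-1-mod-4 {m} {n} {k} q sign x≡-1[4] 7≤x sol =
    Lᶻ[1+2q]≢2-mod-4 q (mod-∣ (≡mod⇒∣ x≡-1[4]) L≡2)
    where
    t : ℕ
    t = suc (q ℕ.+ q)
    N : ℤ
    N = Lᶻ m + 1ℤ
    x≡-1 : Lᶻ m ≡ -1ℤ mod N
    x≡-1 = ∣⇒≡mod ∣-refl
    odd : -1ℤ ^ (n ℕ.+ k) ≡ -1ℤ × -1ℤ ^ n ≡ -1ℤ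
    odd = solution⇒odd-exponents q sign 7≤x sol
    -L≡-2 : -1ℤ * Lᶻ t ≡ -1ℤ * + 2 mod N
    -L≡-2 = begin
      -1ℤ * Lᶻ t                  ≡⟨ cong (_* Lᶻ t) (-1^[1+h+h]≡-1 q) ⟨
      -1ℤ ^ t * Lᶻ t              ≡⟨ V[-1,-1]≡±Lᶻ t ⟨
      V -1ℤ -1ℤ t                 ≈⟨ V-cong (mod-sym x≡-1) t ⟩
      V (Lᶻ m) -1ℤ t              ≡⟨ cong (λ σ → V (Lᶻ m) σ t) sign ⟨
      V (Lᶻ m) (-1ℤ ^ m) t        ≈⟨ V-solution (mod-^ x≡-1) sol ⟩
      -1ℤ ^ (n ℕ.+ k) + -1ℤ ^ n   ≡⟨ cong₂ _+_ (proj₁ odd) (proj₂ odd) ⟩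
      -1ℤ * + 2                   ∎
      where open SetoidReasoning (mod-setoid N)
    L≡2 : Lᶻ t ≡ + 2 mod N
    L≡2 = subst (λ a → a ≡ + 2 mod N) (identity (Lᶻ t)) (mod-* (mod-refl {a = -1ℤ}) -L≡-2)
      where
      identity : ∀ y → -1ℤ * (-1ℤ * y) ≡ y
      identity = solve-∀

  no-solution-odd : ∀ {n k} q h → 7 ℕ.≤ L (suc (h ℕ.+ h)) → 2 ℕ.≤ n →
                    ¬ Solution (suc (h ℕ.+ h)) n k (suc (h ℕ.+ h) ℕ.* suc (q ℕ.+ q))
  no-solution-odd q h 7≤x 2≤n sol with L (suc (h ℕ.+ h)) % 4 in x%4
  ... | 0 = 4∣L⇒no-solution (m%n≡0⇒n∣m (L (suc (h ℕ.+ h))) 4 x%4) 2≤n sol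
  ... | 1 = no-solution-L≡1-mod-4 q (-1^[1+h+h]≡-1 h) (%≡⇒mod x%4) sol
  ... | 2 = L[1+2q]%4≢2 h x%4
  ... | 3 = no-solution-L≡-1-mod-4 q (-1^[1+h+h]≡-1 h)
              (mod-trans (%≡⇒mod x%4) (∣⇒≡mod (divides 1ℤ refl))) 7≤x sol
  ... | suc (suc (suc (suc c))) = ℕₚ.m+n≮m 4 c (subst (ℕ._< 4) x%4 (m%n<n (L (suc (h ℕ.+ h))) 4))

  4≤m⇒no-solution : ∀ {m n k r} → 4 ℕ.≤ m → 2 ℕ.≤ n → ¬ Solution m n k r
  4≤m⇒no-solution {m} {n} {k} {r} 4≤m 2≤n sol
    with Lᶻ∣Lᶻ⇒odd-multiple {m} {r} (ℕₚ.≤-trans (s≤s (s≤s z≤n)) 4≤m)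
           (∣ᵤ⇒∣ (Solution⇒L∣L (ℕₚ.≤-trans (s≤s z≤n) 2≤n) sol))
       | parity m
  ... | q , refl | inj₁ (h , refl) = no-solution-even q (-1^[h+h]≡1 h) (7≤L 4≤m) sol
  ... | q , refl | inj₂ (h , refl) = no-solution-odd q h (7≤L 4≤m) 2≤n sol


open ℕ-Lemmas using (Solution; solution; no-solution-m≡2; 4∣L⇒no-solution)
open ℤ-Lemmas using (4≤m⇒no-solution)
open import Data.Nat using (_+_; _^_; _≤_)
open import Data.Nat.Properties using (m≤n⇒m<n∨m≡n)
open import Data.Nat.Divisibility using (divides)

mainTheorem1 : (r m n k : ℕ) → 1 ≤ r → 2 ≤ m → 2 ≤ n → 1 ≤ k →
    ¬ (L m ^ (n + k) + L m ^ n ≡ L r)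
mainTheorem1 r m n k _ 2≤m 2≤n 1≤k eq = no-solution 2≤m 2≤n 1≤k (solution {r = r} eq)
  where
  no-solution : ∀ {m n k r} → 2 ≤ m → 2 ≤ n → 1 ≤ k → ¬ Solution m n k r
  no-solution 2≤m 2≤n 1≤k sol with m≤n⇒m<n∨m≡n 2≤m
  ... | inj₂ refl = no-solution-m≡2 2≤n 1≤k sol
  ... | inj₁ 3≤m with m≤n⇒m<n∨m≡n 3≤m
  ...   | inj₂ refl = 4∣L⇒no-solution (divides 1 refl) 2≤n sol
  ...   | inj₁ 4≤m  = 4≤m⇒no-solution 4≤m 2≤n sol
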